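{- Let $n\geq 1$ be an integer and put $r=\left\lfloor \frac{\sqrt{4n+1}+1}{2}\right\rfloor$. Then every attainable partition of $n$ has length at most $r$. Moreover, this bound is realized by the partition $\lambda=(n-r+1,1,\dots,1)$ of $n$ (with $r-1$ parts equal to $1$), which satisfies $0\leq c(\lambda)<\sqrt{4n+1}$.
   Context: A partition of a positive integer $n$ is a tuple $\lambda=(n_1,n_2,\dots,n_r)$ of positive integers with $n_1\geq n_2\geq\dots\geq n_r$ and $n_1+\dots+n_r=n$; $r$ is its length. The cyclicity index of $\lambda$ is $c(\lambda)=\sum_{i=1}^r(3-2i)n_i$. The partition $\lambda$ is called attainable if $c(\lambda)\geq 0$. -}

module Defs where

open import Data.Nat using (ℕ; zero; suc; _+_; _*_; _∸_; _≤_; _≥_; _≤?_; _/_)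
open import Data.Bool using (if_then_else_)
open import Relation.Nullary.Decidable using (⌊_⌋)
open import Data.List using (List; []; _∷_)
open import Data.Nat.ListAction using (sum)
open import Data.List.Relation.Unary.All using (All)
open import Data.List.Relation.Unary.Linked using (Linked)
open import Data.Integer as ℤ using (ℤ; +_)
open import Data.Product using (_×_)
open import Relation.Binary.PropositionalEquality using (_≡_)

isqrt : ℕ → ℕ
isqrt zero = zero
isqrt (suc m) with isqrt m
... | k = if ⌊ suc k * suc k ≤? suc m ⌋ then suc k else k

-- r(n) = ⌊ (√(4n+1) + 1) / 2 ⌋ = ⌊ (⌊√(4n+1)⌋ + 1) / 2 ⌋
bound : ℕ → ℕ
bound n = (isqrt (4 * n + 1) + 1) / 2

IsPartition : ℕ → List ℕ → Set
IsPartition n λs = All (λ k → 1 ≤ k) λs × Linked _≥_ λs × sum λs ≡ n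

cycFrom : ℕ → List ℕ → ℤ
cycFrom i [] = + 0
cycFrom i (x ∷ xs) = ((+ 3) ℤ.- (+ (2 * i))) ℤ.* (+ x) ℤ.+ cycFrom (suc i) xs

-- cyclicity index c(λ) = Σ_{i=1}^r (3 - 2i) n_i
cyc : List ℕ → ℤ
cyc = cycFrom 1

Attainable : List ℕ → Set
Attainable λs = + 0 ℤ.≤ cyc λs

-- Write q(q+1) ≤ n < (q+1)(q+2); then r = q + 1, because the odd square (2q+1)^2 = 4q(q+1) + 1
-- brackets ⌊√(4n+1)⌋ between 2q+1 and 2q+2. If λ = (x, x_1, …, x_m) is attainable then
-- x ≥ Σ (2i-1) x_i ≥ m^2, and every x_i ≥ 1, so n ≥ m^2 + m; hence m ≤ q and the length is at
-- most r. The hook (n - q, 1^q) has cyclicity index e = n - q(q+1), and e ≤ 2q+1 gives e^2 < 4n+1.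
module Submission where

open import Defs
open import Data.Nat
open import Data.Nat.Properties
open import Data.Nat.DivMod using (m≡m%n+[m/n]*n; m%n<n; m/n*n≤m)
open import Data.Nat.ListAction using (sum)
open import Data.Nat.Tactic.RingSolver using (solve-∀)
open import Data.Product using (∃-syntax; _×_; _,_; proj₁; proj₂)
open import Data.List using (List; []; _∷_; length; replicate)
open import Data.List.Properties using (length-replicate)
open import Data.List.Relation.Unary.All using (All; []; _∷_)
open import Data.List.Relation.Unary.All.Properties using (replicate⁺)
open import Data.List.Relation.Unary.Linked using (Linked; [-]; _∷_)
open import Data.Integer as ℤ using (+_)
import Data.Integer.Properties as ℤ
import Data.Integer.Tactic.RingSolver as ℤ-Solver
open import Relation.Nullary using (contradiction)
open import Relation.Nullary.Decidable using (yes; no)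
open import Relation.Binary.PropositionalEquality

isqrt-floor : ∀ m → isqrt m * isqrt m ≤ m × m < suc (isqrt m) * suc (isqrt m)
isqrt-floor zero = z≤n , s≤s z≤n
isqrt-floor (suc m) with isqrt m | isqrt-floor m
... | k | lo , hi with suc k * suc k ≤? suc m
... | yes k+1²≤ = k+1²≤ , ≤-<-trans hi (*-mono-< (n<1+n (suc k)) (n<1+n (suc k)))
... | no k+1²≰ = m≤n⇒m≤1+n lo , ≰⇒> k+1²≰

pronic : ℕ → ℕ
pronic k = k * suc k

pronic-mono-≤ : ∀ {m n} → m ≤ n → pronic m ≤ pronic n
pronic-mono-≤ m≤n = *-mono-≤ m≤n (s≤s m≤n)

pronic-cancel-< : ∀ {m n} → pronic m < pronic n → m < n
pronic-cancel-< {m} {n} p with m <? n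
... | yes m<n = m<n
... | no m≮n = contradiction p (≤⇒≯ (pronic-mono-≤ (≮⇒≥ m≮n)))

odd-square : ∀ q → (1 + 2 * q) * (1 + 2 * q) ≡ 4 * pronic q + 1
odd-square q = expand q
  where
  expand : ∀ q → (1 + 2 * q) * (1 + 2 * q) ≡ 4 * (q * suc q) + 1
  expand = solve-∀

-- The last two hypotheses say r = ⌊(s + 1)/2⌋, so s is 2r - 1 or 2r.
pronic-bracket : ∀ {n s r} → s * s ≤ 4 * n + 1 → 4 * n + 1 < suc s * suc s →
                 r * 2 ≤ suc s → suc s < r * 2 + 2 →
                 ∃[ q ] r ≡ suc q × pronic q ≤ n × n < pronic (suc q)
pronic-bracket {n} {zero} {zero} _ 4n+1<1 _ _ = contradiction 4n+1<1 (m+n≮n (4 * n) 1)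
pronic-bracket {s = suc _} {zero} _ _ _ (s≤s (s≤s ()))
pronic-bracket {n} {s} {suc q} s²≤ <[s+1]² 2r≤ <2r+2 = q , refl , pronic[q]≤n , n<pronic[q+1]
  where
  2q+1≤s : 1 + 2 * q ≤ s
  2q+1≤s = subst (_≤ s) (cong suc (*-comm q 2)) (s≤s⁻¹ 2r≤)
  s+1≤2q+3 : suc s ≤ 1 + 2 * suc q
  s+1≤2q+3 = subst (suc s ≤_) (q*2+3≡ q) (s≤s (s≤s⁻¹ (s≤s⁻¹ <2r+2)))
    where
    q*2+3≡ : ∀ q → suc (q * 2 + 2) ≡ 1 + 2 * suc q
    q*2+3≡ = solve-∀
  pronic[q]≤n : pronic q ≤ n
  pronic[q]≤n = *-cancelˡ-≤ 4 (+-cancelʳ-≤ 1 _ _ (begin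
    4 * pronic q + 1             ≡⟨ odd-square q ⟨
    (1 + 2 * q) * (1 + 2 * q)    ≤⟨ *-mono-≤ 2q+1≤s 2q+1≤s ⟩
    s * s                        ≤⟨ s²≤ ⟩
    4 * n + 1                    ∎))
    where open ≤-Reasoning
  n<pronic[q+1] : n < pronic (suc q)
  n<pronic[q+1] = *-cancelˡ-< 4 n _ (+-cancelʳ-< 1 _ _ (begin-strict
    4 * n + 1                            <⟨ <[s+1]² ⟩
    suc s * suc s                        ≤⟨ *-mono-≤ s+1≤2q+3 s+1≤2q+3 ⟩
    (1 + 2 * suc q) * (1 + 2 * suc q)    ≡⟨ odd-square (suc q) ⟩
    4 * pronic (suc q) + 1               ∎))
    where open ≤-Reasoning

bound-pronic : ∀ n → ∃[ q ] bound n ≡ suc q × pronic q ≤ n × n < pronic (suc q)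
bound-pronic n = pronic-bracket (proj₁ (isqrt-floor (4 * n + 1))) (proj₂ (isqrt-floor (4 * n + 1)))
                                half*2≤ <half*2+2
  where
  s = isqrt (4 * n + 1)
  half*2≤ : (s + 1) / 2 * 2 ≤ suc s
  half*2≤ = subst ((s + 1) / 2 * 2 ≤_) (+-comm s 1) (m/n*n≤m (s + 1) 2)
  <half*2+2 : suc s < (s + 1) / 2 * 2 + 2
  <half*2+2 = begin-strict
    suc s                          ≡⟨ +-comm 1 s ⟩
    s + 1                          ≡⟨ m≡m%n+[m/n]*n (s + 1) 2 ⟩
    (s + 1) % 2 + (s + 1) / 2 * 2  <⟨ +-monoˡ-< _ (m%n<n (s + 1) 2) ⟩
    2 + (s + 1) / 2 * 2            ≡⟨ +-comm 2 _ ⟩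
    (s + 1) / 2 * 2 + 2            ∎
    where open ≤-Reasoning

-- Σᵢ (2(k + i) + 1) xᵢ: minus the contribution to c of parts at positions k + 2, k + 3, …
tailWeightFrom : ℕ → List ℕ → ℕ
tailWeightFrom k [] = 0
tailWeightFrom k (x ∷ xs) = (1 + 2 * k) * x + tailWeightFrom (suc k) xs

tailWeight : List ℕ → ℕ
tailWeight = tailWeightFrom 0

cycFrom-shift : ∀ k xs → cycFrom (2 + k) xs ≡ ℤ.- + tailWeightFrom k xs
cycFrom-shift k [] = refl
cycFrom-shift k (x ∷ xs) = begin
  (+ 3 ℤ.- + (2 * (2 + k))) ℤ.* + x ℤ.+ cycFrom (3 + k) xs
    ≡⟨ cong₂ (λ c t → c ℤ.* + x ℤ.+ t) coefficient (cycFrom-shift (suc k) xs) ⟩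
  ℤ.- c ℤ.* + x ℤ.+ ℤ.- t
    ≡⟨ cong (ℤ._+ ℤ.- t) (ℤ.neg-distribˡ-* c (+ x)) ⟨
  ℤ.- (c ℤ.* + x) ℤ.+ ℤ.- t
    ≡⟨ ℤ.neg-distrib-+ (c ℤ.* + x) t ⟨
  ℤ.- (c ℤ.* + x ℤ.+ t)
    ≡⟨ cong (λ u → ℤ.- (u ℤ.+ t)) (ℤ.pos-* (1 + 2 * k) x) ⟨
  ℤ.- (+ ((1 + 2 * k) * x) ℤ.+ t)
    ≡⟨ cong ℤ.-_ (ℤ.pos-+ ((1 + 2 * k) * x) _) ⟨
  ℤ.- + tailWeightFrom k (x ∷ xs) ∎
  where
  open ≡-Reasoning
  c = + (1 + 2 * k)
  t = + tailWeightFrom (suc k) xs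
  coefficient : + 3 ℤ.- + (2 * (2 + k)) ≡ ℤ.- c
  coefficient = begin
    + 3 ℤ.- + (2 * (2 + k))         ≡⟨ cong (λ u → + 3 ℤ.- u) (ℤ.pos-* 2 (2 + k)) ⟩
    + 3 ℤ.- + 2 ℤ.* + (2 + k)       ≡⟨ cong (λ u → + 3 ℤ.- + 2 ℤ.* u) (ℤ.pos-+ 2 k) ⟩
    + 3 ℤ.- + 2 ℤ.* (+ 2 ℤ.+ + k)   ≡⟨ ring-identity (+ k) ⟩
    ℤ.- (+ 1 ℤ.+ + 2 ℤ.* + k)       ≡⟨ cong (λ u → ℤ.- (+ 1 ℤ.+ u)) (ℤ.pos-* 2 k) ⟨
    ℤ.- (+ 1 ℤ.+ + (2 * k))         ≡⟨ cong ℤ.-_ (ℤ.pos-+ 1 (2 * k)) ⟨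
    ℤ.- c                           ∎
    where
    ring-identity : ∀ j → + 3 ℤ.- + 2 ℤ.* (+ 2 ℤ.+ j) ≡ ℤ.- (+ 1 ℤ.+ + 2 ℤ.* j)
    ring-identity = ℤ-Solver.solve-∀

cyc-∷ : ∀ x xs → cyc (x ∷ xs) ≡ + x ℤ.- + tailWeight xs
cyc-∷ x xs = cong₂ ℤ._+_ (ℤ.*-identityˡ (+ x)) (cycFrom-shift 0 xs)

attainable-∷⇒tailWeight≤head : ∀ {x xs} → Attainable (x ∷ xs) → tailWeight xs ≤ x
attainable-∷⇒tailWeight≤head {x} {xs} att =
  ℤ.drop‿+≤+ (ℤ.0≤i-j⇒j≤i (subst (ℤ._≤_ (+ 0)) (cyc-∷ x xs) att))

tailWeightFrom-replicate : ∀ k m → tailWeightFrom k (replicate m 1) ≡ 2 * k * m + m * m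
tailWeightFrom-replicate k zero = sym (trans (+-identityʳ (2 * k * 0)) (*-zeroʳ (2 * k)))
tailWeightFrom-replicate k (suc m) =
  trans (cong (_+_ ((1 + 2 * k) * 1)) (tailWeightFrom-replicate (suc k) m)) (expand k m)
  where
  expand : ∀ k m → (1 + 2 * k) * 1 + (2 * suc k * m + m * m) ≡ 2 * k * suc m + suc m * suc m
  expand = solve-∀

tailWeightFrom-replicate-≤ : ∀ k {xs} → All (1 ≤_) xs →
                               tailWeightFrom k (replicate (length xs) 1) ≤ tailWeightFrom k xs
tailWeightFrom-replicate-≤ k [] = ≤-refl
tailWeightFrom-replicate-≤ k (1≤x ∷ 1≤xs) =
  +-mono-≤ (*-monoʳ-≤ (1 + 2 * k) 1≤x) (tailWeightFrom-replicate-≤ (suc k) 1≤xs)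

length≤sum : ∀ {xs} → All (1 ≤_) xs → length xs ≤ sum xs
length≤sum [] = z≤n
length≤sum (1≤x ∷ 1≤xs) = +-mono-≤ 1≤x (length≤sum 1≤xs)

attainable⇒pronic-length≤sum : ∀ {x xs} → All (1 ≤_) (x ∷ xs) → Attainable (x ∷ xs) →
                                pronic (length xs) ≤ sum (x ∷ xs)
attainable⇒pronic-length≤sum {x} {xs} (_ ∷ 1≤xs) att = begin
  pronic m               ≡⟨ *-suc m m ⟩
  m + m * m              ≡⟨ cong (_+_ m) (tailWeightFrom-replicate 0 m) ⟨
  m + tailWeight (replicate m 1)
    ≤⟨ +-mono-≤ (length≤sum 1≤xs)
                (≤-trans (tailWeightFrom-replicate-≤ 0 1≤xs) (attainable-∷⇒tailWeight≤head {x} {xs} att)) ⟩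
  sum xs + x             ≡⟨ +-comm (sum xs) x ⟩
  x + sum xs             ∎
  where
  open ≤-Reasoning
  m = length xs

attainable-length≤ : ∀ {n q λs} → IsPartition n λs → Attainable λs → n < pronic (suc q) →
                     length λs ≤ suc q
attainable-length≤ {λs = []} _ _ _ = z≤n
attainable-length≤ {λs = x ∷ xs} (1≤λs , _ , refl) att n< =
  pronic-cancel-< (≤-<-trans (attainable⇒pronic-length≤sum 1≤λs att) n<)

pronic-suc : ∀ q → pronic (suc q) ≡ pronic q + suc (1 + 2 * q)
pronic-suc q = expand q
  where
  expand : ∀ q → suc q * suc (suc q) ≡ q * suc q + suc (1 + 2 * q)
  expand = solve-∀

pronic-≤⇒< : ∀ {q n} → 0 < n → pronic q ≤ n → q < n
pronic-≤⇒< {zero} 0<n _ = 0<n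
pronic-≤⇒< {suc q} _ p = <-≤-trans (m<m*n (suc q) (suc (suc q)) (s≤s (s≤s z≤n))) p

excess-square< : ∀ q e → e ≤ 1 + 2 * q → e * e < 4 * (pronic q + e) + 1
excess-square< q zero _ = m≤n+m 1 (4 * (pronic q + 0))
excess-square< q (suc e) e+1≤2q+1 = begin-strict
  suc e * suc e                  ≤⟨ *-mono-≤ e+1≤2q+1 e+1≤2q+1 ⟩
  (1 + 2 * q) * (1 + 2 * q)      ≡⟨ odd-square q ⟩
  4 * pronic q + 1               <⟨ +-monoˡ-< 1 (*-monoʳ-< 4 (m<m+n (pronic q) (s≤s z≤n))) ⟩
  4 * (pronic q + suc e) + 1     ∎
  where open ≤-Reasoning

hook : ℕ → ℕ → List ℕ
hook a m = a ∷ replicate m 1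

sum-replicate : ∀ m x → sum (replicate m x) ≡ m * x
sum-replicate zero x = refl
sum-replicate (suc m) x = cong (_+_ x) (sum-replicate m x)

hook-linked : ∀ {a} → 1 ≤ a → ∀ m → Linked _≥_ (hook a m)
hook-linked _ zero = [-]
hook-linked 1≤a (suc m) = 1≤a ∷ hook-linked ≤-refl m

hook-isPartition : ∀ {a} → 1 ≤ a → ∀ m → IsPartition (a + m) (hook a m)
hook-isPartition {a} 1≤a m =
  1≤a ∷ replicate⁺ m ≤-refl ,
  hook-linked 1≤a m ,
  cong (_+_ a) (trans (sum-replicate m 1) (*-identityʳ m))

cyc-hook : ∀ m e → cyc (hook (m * m + e) m) ≡ + e
cyc-hook m e = begin
  cyc (hook (m * m + e) m)                         ≡⟨ cyc-∷ (m * m + e) (replicate m 1) ⟩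
  + (m * m + e) ℤ.- + tailWeight (replicate m 1)   ≡⟨ cong (λ w → + (m * m + e) ℤ.- + w) (tailWeightFrom-replicate 0 m) ⟩
  + (m * m + e) ℤ.- + (m * m)                      ≡⟨ ℤ.[+m]-[+n]≡m⊖n (m * m + e) (m * m) ⟩
  (m * m + e) ℤ.⊖ (m * m)                          ≡⟨ ℤ.⊖-≥ (m≤m+n (m * m) e) ⟩
  + (m * m + e ∸ m * m)                            ≡⟨ cong +_ (m+n∸m≡n (m * m) e) ⟩
  + e                                              ∎
  where open ≡-Reasoning

hook-witness : ∀ {n q} → 1 ≤ n → pronic q ≤ n → n < pronic (suc q) →
               let λs = hook (n ∸ suc q + 1) q in
               IsPartition n λs × length λs ≡ suc q ×
               + 0 ℤ.≤ cyc λs × cyc λs ℤ.* cyc λs ℤ.< + (4 * n + 1)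
hook-witness {n} {q} 1≤n pronic[q]≤n n<pronic[q+1] =
  subst (λ s → IsPartition s (hook a q)) a+q≡n (hook-isPartition (m≤n+m 1 _) q) ,
  cong suc (length-replicate q) ,
  subst (+ 0 ℤ.≤_) (sym cyc≡e) (ℤ.+≤+ z≤n) ,
  subst (λ c → c ℤ.* c ℤ.< + (4 * n + 1)) (sym cyc≡e) e²<4n+1
  where
  open ≡-Reasoning
  a = n ∸ suc q + 1
  e = n ∸ pronic q
  pronic[q]+e≡n : pronic q + e ≡ n
  pronic[q]+e≡n = m+[n∸m]≡n pronic[q]≤n
  a+q≡n : a + q ≡ n
  a+q≡n = trans (+-assoc (n ∸ suc q) 1 q) (m∸n+n≡m (pronic-≤⇒< 1≤n pronic[q]≤n))
  a≡q²+e : a ≡ q * q + e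
  a≡q²+e = +-cancelʳ-≡ q a (q * q + e) (begin
    a + q               ≡⟨ a+q≡n ⟩
    n                   ≡⟨ pronic[q]+e≡n ⟨
    pronic q + e        ≡⟨ cong (_+ e) (*-suc q q) ⟩
    q + q * q + e       ≡⟨ +-assoc q (q * q) e ⟩
    q + (q * q + e)     ≡⟨ +-comm q (q * q + e) ⟩
    q * q + e + q       ∎)
  cyc≡e : cyc (hook a q) ≡ + e
  cyc≡e = trans (cong (λ h → cyc (hook h q)) a≡q²+e) (cyc-hook q e)
  e≤2q+1 : e ≤ 1 + 2 * q
  e≤2q+1 = s≤s⁻¹ (+-cancelˡ-< (pronic q) e _
    (subst₂ _<_ (sym pronic[q]+e≡n) (pronic-suc q) n<pronic[q+1]))
  e²<4n+1 : + e ℤ.* + e ℤ.< + (4 * n + 1)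
  e²<4n+1 = subst₂ ℤ._<_ (ℤ.pos-* e e) refl
    (ℤ.+<+ (subst (λ m → e * e < 4 * m + 1) pronic[q]+e≡n (excess-square< q e e≤2q+1)))

theorem1p3 : (n : ℕ) → 1 ≤ n →
    ((λs : List ℕ) → IsPartition n λs → Attainable λs → length λs ≤ bound n)
    × (IsPartition n ((n ∸ bound n + 1) ∷ replicate (bound n ∸ 1) 1)
    × length ((n ∸ bound n + 1) ∷ replicate (bound n ∸ 1) 1) ≡ bound n
    × + 0 ℤ.≤ cyc ((n ∸ bound n + 1) ∷ replicate (bound n ∸ 1) 1)
    × cyc ((n ∸ bound n + 1) ∷ replicate (bound n ∸ 1) 1) ℤ.* cyc ((n ∸ bound n + 1) ∷ replicate (bound n ∸ 1) 1) ℤ.< + (4 * n + 1))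
theorem1p3 n 1≤n with bound-pronic n
... | q , bound≡q+1 , pronic[q]≤n , n<pronic[q+1] rewrite bound≡q+1 =
  (λ λs partition att → attainable-length≤ partition att n<pronic[q+1]) ,
  hook-witness 1≤n pronic[q]≤n n<pronic[q+1]
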